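{- Let $G=(V,E)$ be a simple graph, $\pi\in\Pi$, and let $\vec P$ be any $(v,\pi)$-query-path for some $v\in V$. Then $\rho(G,\pi)\ge\lfloor|\vec P|/2\rfloor$.
   Context: $\Pi$ denotes the set of all bijections $\pi:E\to\{1,\dots,|E|\}$ (ranks). Vertex oracle $\mathrm{VO}(v,\pi)$: let $e_1=(v,u_1),\dots,e_k=(v,u_k)$ be the edges incident to $v$ with $\pi(e_1)<\dots<\pi(e_k)$; for $i=1,\dots,k$, if $\mathrm{EO}(e_i,u_i,\pi)$ returns true then return true; after the loop return false. Edge oracle $\mathrm{EO}(e,u,\pi)$, $u$ an endpoint of $e$: if $\mathrm{EO}(e,u,\pi)$ has already been computed during the current execution of the top-level vertex oracle call, return the stored answer (making no further calls). Otherwise let $e_1=(u,w_1),\dots,e_k=(u,w_k)$ be the edges incident to $u$ with $\pi(e_i)<\pi(e)$ and $\pi(e_1)<\dots<\pi(e_k)$; for $i=1,\dots,k$, if $\mathrm{EO}(e_i,w_i,\pi)$ returns true then return false; after the loop return true. Query paths: during the execution of $\mathrm{VO}(v,\pi)$ maintain a stack, pushing an edge when the edge oracle is called on it and popping it when that call returns. At any moment the edges in the stack, $(e_1,\dots,e_k)$ in push order, form a path in $G$ with $v\in e_1$; orienting it as a directed path starting at $v$ gives a $(v,\pi)$-query-path of length $k$. Parallel randomized greedy maximal matching: starting from $G$, repeat in rounds until the graph has no edges: simultaneously add to the matching every edge that is a local minimum (its rank is smaller than that of every adjacent edge still in the current graph), then delete the endpoints of all these edges (with their incident edges) from the graph.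 $\rho(G,\pi)$ is the number of rounds until the graph becomes empty. -}

module Defs where

open import Data.Nat using (ℕ; zero; suc; _<ᵇ_)
open import Data.Fin using (Fin; toℕ)
open import Data.Fin.Properties using (_≟_)
open import Data.Bool using (Bool; true; false; not; _∧_; _∨_; if_then_else_)
open import Data.Maybe using (Maybe; just; nothing)
open import Data.Product using (_×_; _,_; proj₁; proj₂; swap)
open import Data.Sum using (_⊎_)
open import Data.List using (List; []; _∷_; _++_; map; mapMaybe; allFin)
open import Data.Bool.ListAction using (any; all)
open import Data.List.Membership.Propositional using (_∈_)
open import Relation.Nullary using (¬_; does)
open import Relation.Binary.PropositionalEquality using (_≡_)
open import Function.Bundles using (_↔_; Inverse)

record SimpleGraph : Set where
  field
    n          : ℕ
    m          : ℕ
    ends       : Fin m → Fin n × Fin n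
    loopless   : ∀ e → ¬ (proj₁ (ends e) ≡ proj₂ (ends e))
    noParallel : ∀ e f → (ends e ≡ ends f) ⊎ (ends e ≡ swap (ends f)) → e ≡ f

open SimpleGraph public

Vertex : SimpleGraph → Set
Vertex G = Fin (n G)

Edge : SimpleGraph → Set
Edge G = Fin (m G)

-- A ranking π ∈ Π: a bijection E → {1,…,|E|}; we use the 0-based
-- ranks {0,…,|E|-1} = Fin |E| (only the relative order matters).
Ranking : SimpleGraph → Set
Ranking G = Edge G ↔ Fin (m G)

module Execution (G : SimpleGraph) (π : Ranking G) where

  V = Vertex G
  E = Edge G

  rank : E → ℕ
  rank e = toℕ (Inverse.to π e)

  edgesByRank : List E
  edgesByRank = map (Inverse.from π) (allFin (m G))

  _==_ : ∀ {k} → Fin k → Fin k → Bool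
  x == y = does (x ≟ y)

  other : V → E → Maybe V
  other u f with ends G f
  ... | (a , b) = if a == u then just b else (if b == u then just a else nothing)

  incident : V → List (E × V)
  incident u = mapMaybe (λ f → Data.Maybe.map (f ,_) (other u f)) edgesByRank

  lowerIncident : E → V → List (E × V)
  lowerIncident e u =
    mapMaybe (λ f → if rank f <ᵇ rank e
                    then Data.Maybe.map (f ,_) (other u f) else nothing)
             edgesByRank

  -- Memo: already computed answers of EO(e,u,π) in the current top-level
  -- execution.
  -- Every call of EO pushes its edge; we record the stack contents right
  -- after every push (all stack contents that ever occur are of this form,
  -- apart from the empty stack).

  Memo   = List ((E × V) × Bool)
  Stack  = List E
  Stacks = List Stack

  lookupMemo : Memo → E → V → Maybe Bool
  lookupMemo [] e u = nothing
  lookupMemo (((f , w) , b) ∷ xs) e u =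
    if (f == e) ∧ (w == u) then just b else lookupMemo xs e u

  -- `fuel` is a recursion bound only: the invariant  rank e < fuel  holds
  -- for every call (ranks strictly decrease along nested EO calls and
  -- the top level uses fuel = |E|), so the `zero` case is never reached.
  mutual
    EO : ℕ → Stack → E → V → Memo → Bool × Memo × Stacks
    EO fuel stk e u memo with lookupMemo memo e u
    ... | just b  = b , memo , (stk ++ (e ∷ [])) ∷ []
    ... | nothing = EO-compute fuel (stk ++ (e ∷ [])) e u memo

    EO-compute : ℕ → Stack → E → V → Memo → Bool × Memo × Stacks
    EO-compute zero    stk' e u memo = false , memo , stk' ∷ []
    EO-compute (suc k) stk' e u memo with loop k stk' (lowerIncident e u) memo
    ... | (r , memo' , ps) = not r , ((e , u) , not r) ∷ memo' , stk' ∷ ps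

    loop : ℕ → Stack → List (E × V) → Memo → Bool × Memo × Stacks
    loop fuel stk [] memo = false , memo , []
    loop fuel stk ((f , w) ∷ xs) memo with EO fuel stk f w memo
    ... | (true  , memo' , ps) = true , memo' , ps
    ... | (false , memo' , ps) with loop fuel stk xs memo'
    ...   | (r , memo'' , qs) = r , memo'' , ps ++ qs

  VO : V → Bool × Memo × Stacks
  VO v = loop (m G) [] (incident v) []

  -- the (v,π)-query-paths (as the edge sequences e_1,…,e_k, in push order)
  queryPaths : V → Stacks
  queryPaths v = proj₂ (proj₂ (VO v))

  -- Parallel randomized greedy maximal matching.
  -- Current graph: vertices with alive = true, and the edges of G with
  -- both endpoints alive.

  Alive = V → Bool

  edgeAlive : Alive → E → Bool
  edgeAlive a e = a (proj₁ (ends G e)) ∧ a (proj₂ (ends G e))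

  adjacent : E → E → Bool
  adjacent e f with ends G e | ends G f
  ... | (a , b) | (c , d) = not (e == f) ∧ ((a == c) ∨ (a == d) ∨ (b == c) ∨ (b == d))

  localMin : Alive → E → Bool
  localMin a e = edgeAlive a e ∧
    all (λ f → not (edgeAlive a f ∧ adjacent e f) ∨ (rank e <ᵇ rank f)) (allFin (m G))

  step : Alive → Alive
  step a x = a x ∧ not (any (λ e → localMin a e ∧
                   ((proj₁ (ends G e) == x) ∨ (proj₂ (ends G e) == x))) (allFin (m G)))

  -- number of rounds until no edge remains; fuel bound only (every round
  -- removes at least one edge, so |E| rounds of fuel always suffice).
  rounds : ℕ → Alive → ℕ
  rounds zero    a = zero
  rounds (suc k) a = if any (edgeAlive a) (allFin (m G)) then suc (rounds k (step a)) else zero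

  ρ : ℕ
  ρ = rounds (m G) (λ _ → true)

ρ : (G : SimpleGraph) → Ranking G → ℕ
ρ G π = Execution.ρ G π

IsQueryPath : (G : SimpleGraph) → Ranking G → Vertex G → List (Edge G) → Set
IsQueryPath G π v P = P ∈ Execution.queryPaths G π v

{-# OPTIONS --safe #-}
-- Write a query path as e₁ e₂ … e_k with e_i = x_{i-1} x_i.  Following the execution of the
-- oracles shows that ranks decrease along it and that x_{i-1} is matched by no edge of rank
-- below π(e_i): e_i is only queried once every cheaper edge at x_{i-1} has been found not to
-- be in the matching, because EO(e,u) answers true exactly when u is matched by no edge of
-- rank below π(e).  While e_{i+1} is alive, so is e_i: the only matching edge
-- that could remove x_{i-1} is e_i itself, and e_i is no local minimum while the cheaper
-- adjacent edge e_{i+1} is present.  Going one edge further, if e_{i+2} is alive in some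
-- round, then both endpoints of e_i survive that round, so e_i lives one round longer.
-- Hence e₁ survives the first ⌊(k-1)/2⌋ rounds, and ρ(G,π) ≥ ⌊k/2⌋.
module Submission where

open import Defs
open import Data.Bool using (Bool; true; false; T; not; _∧_; _∨_; if_then_else_)
open import Data.Bool.ListAction using (any; all)
open import Data.Bool.Properties using (T-∧; T-∨; T?)
open import Data.Empty using (⊥-elim)
open import Data.Fin using (Fin; toℕ)
open import Data.Fin.Properties using (_≟_; toℕ-injective; toℕ<n)
open import Data.List using (List; []; _∷_; _++_; mapMaybe; allFin; length)
open import Data.List.Membership.Propositional using (_∈_; find; lose)
open import Data.List.Membership.Propositional.Properties using (∈-allFin; ∈-map⁺)
open import Data.List.Properties using (length-++-comm)
open import Data.List.Relation.Unary.All as All using (All; []; _∷_)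
import Data.List.Relation.Unary.All.Properties as All
open import Data.List.Relation.Unary.AllPairs using (AllPairs; []; _∷_)
import Data.List.Relation.Unary.AllPairs.Properties as AllPairs
open import Data.List.Relation.Unary.Any as Any using (Any; here; there)
import Data.List.Relation.Unary.Any.Properties as Any
open import Data.Maybe as Maybe using (Maybe; just; nothing)
import Data.Maybe.Relation.Unary.All as MaybeAll
import Data.Maybe.Relation.Unary.Any as MaybeAny
open import Data.Nat
  using (ℕ; zero; suc; _+_; ⌊_/2⌋; _≤_; _<_; _≤′_; ≤′-reflexive; ≤′-step; _<ᵇ_; z≤n; s≤s)
open import Data.Nat.GeneralisedArithmetic using (fold; iterate; iterate-is-fold)
open import Data.Nat.Induction using (<-wellFounded)
open import Data.Nat.Properties
  using ( <ᵇ⇒<; <⇒<ᵇ; <ᵇ-reflects-<; ≤⇒≤′; ≤-refl; ≤-trans; ≤-antisym; <⇒≤; <-cmp; <-asym; <-irrefl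
        ; <-trans; ≤-<-trans; <-≤-trans; <⇒≢; ≮⇒≥; <⇒≱; n≤1+n; +-suc; +-identityʳ; ⌊n/2⌋-mono )
open import Data.Product as Product using (_×_; _,_; proj₁; proj₂; ∃-syntax; uncurry)
open import Data.Sum using (_⊎_; inj₁; inj₂)
open import Data.Unit using (⊤)
open import Function using (id; _∘_; case_of_; _on_; _⇔_; mk⇔; Injection; Inverse; Equivalence)
open import Function.Properties.Inverse using (↔⇒↣)
open import Induction.WellFounded using (Acc; acc)
open import Relation.Binary.Definitions using (tri<; tri≈; tri>)
open import Relation.Binary.PropositionalEquality using (_≡_; _≢_; refl; sym; trans; cong; subst; subst₂)
open import Relation.Nullary using (¬_; Dec; yes; no; contradiction)
open import Relation.Nullary.Decidable using (map′)
open import Relation.Nullary.Reflects using (Reflects; ofʸ; ofⁿ; ¬-reflects)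
import Relation.Unary as U

open Equivalence using (to; from)

T-∨⁺ˡ : ∀ {b c} → T b → T (b ∨ c)
T-∨⁺ˡ {true} _ = _

T-∨⁺ʳ : ∀ b {c} → T c → T (b ∨ c)
T-∨⁺ʳ true  _  = _
T-∨⁺ʳ false tc = tc

T-not-∨⁺ : ∀ {b c} → (T b → T c) → T (not b ∨ c)
T-not-∨⁺ {false} _ = _
T-not-∨⁺ {true}  k = k _

T-not-∨⁻ : ∀ {b c} → T (not b ∨ c) → T b → T c
T-not-∨⁻ {true} tc _ = tc

T-not⇒¬T : ∀ {b} → T (not b) → ¬ T b
T-not⇒¬T {false} _ ()

T-∧-not⁻ : ∀ {b c} → T b → ¬ T (b ∧ not c) → T c
T-∧-not⁻ {true} {true}  _ _  = _
T-∧-not⁻ {true} {false} _ ¬t = ¬t _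

crossing : ∀ {P : ℕ → Set} → U.Decidable P → P 0 → ∀ N → ¬ P N → ∃[ t ] P t × ¬ P (suc t)
crossing P? p₀ zero    ¬p₀ = contradiction p₀ ¬p₀
crossing P? p₀ (suc N) ¬pₙ with P? N
... | yes pₙ  = N , pₙ , ¬pₙ
... | no ¬pₙ′ = crossing P? p₀ N ¬pₙ′

Reflects-⇔ : ∀ {A B : Set} {b} → A ⇔ B → Reflects A b → Reflects B b
Reflects-⇔ A⇔B (ofʸ a)  = ofʸ (to A⇔B a)
Reflects-⇔ A⇔B (ofⁿ ¬a) = ofⁿ (¬a ∘ from A⇔B)

there-reflects : ∀ {A : Set} {P : A → Set} {x xs b} → ¬ P x → Reflects (Any P xs) b →
                 Reflects (Any P (x ∷ xs)) b
there-reflects ¬px (ofʸ pxs)  = ofʸ (there pxs)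
there-reflects ¬px (ofⁿ ¬pxs) = ofⁿ λ { (here px) → ¬px px ; (there pxs) → ¬pxs pxs }

module _ {A B : Set} {p : A → Maybe B} {key : B → A}
         (p-key : ∀ {x y} → p x ≡ just y → key y ≡ x) where

  All-mapMaybe-key : ∀ {P : A → Set} {xs} → All P xs → All (P ∘ key) (mapMaybe p xs)
  All-mapMaybe-key {P} = All.mapMaybe⁺ ∘ All.map⁺ ∘ All.map keep
    where
      keep : ∀ {x} → P x → MaybeAll.All (P ∘ key) (p x)
      keep {x} px with p x in eq
      ... | just y  = MaybeAll.just (subst P (sym (p-key eq)) px)
      ... | nothing = MaybeAll.nothing

  AllPairs-mapMaybe-key : ∀ {R : A → A → Set} {xs} → AllPairs R xs → AllPairs (R on key) (mapMaybe p xs)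
  AllPairs-mapMaybe-key {R} {x ∷ xs} (rx ∷ rxs) with p x in eq
  ... | just y  = subst (λ z → All (R z ∘ key) (mapMaybe p xs)) (sym (p-key eq)) (All-mapMaybe-key rx)
                ∷ AllPairs-mapMaybe-key rxs
  ... | nothing = AllPairs-mapMaybe-key rxs
  AllPairs-mapMaybe-key [] = []

  ∈-mapMaybe-key⁻ : ∀ {xs y} → y ∈ mapMaybe p xs → p (key y) ≡ just y
  ∈-mapMaybe-key⁻ {x ∷ xs} y∈ with p x in eq | y∈
  ... | nothing | y∈′        = ∈-mapMaybe-key⁻ {xs} y∈′
  ... | just _  | here refl  = subst (λ z → p z ≡ just _) (sym (p-key eq)) eq
  ... | just _  | there y∈′  = ∈-mapMaybe-key⁻ {xs} y∈′

∈-mapMaybe⁺ : ∀ {A B : Set} (p : A → Maybe B) {xs x y} → x ∈ xs → p x ≡ just y → y ∈ mapMaybe p xs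
∈-mapMaybe⁺ p {xs} x∈ eq =
  Any.mapMaybe⁺ p xs (Any.map⁺ (lose x∈ (subst (MaybeAny.Any (_ ≡_)) (sym eq) (MaybeAny.just refl))))

module Greedy (G : SimpleGraph) (π : Ranking G) where
  open Execution G π hiding (ρ)

  rank-injective : ∀ {e f} → rank e ≡ rank f → e ≡ f
  rank-injective = Injection.injective (↔⇒↣ π) ∘ toℕ-injective

  rank<m : ∀ e → rank e < m G
  rank<m e = toℕ<n (Inverse.to π e)

  ∈-edgesByRank : ∀ e → e ∈ edgesByRank
  ∈-edgesByRank e = subst (_∈ edgesByRank) (Inverse.strictlyInverseʳ π e)
                      (∈-map⁺ (Inverse.from π) (∈-allFin (Inverse.to π e)))

  edgesByRank-increasing : AllPairs (_<_ on rank) edgesByRank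
  edgesByRank-increasing = AllPairs.map⁺ (AllPairs.tabulate⁺-< λ {i} {j} i<j →
    subst₂ _<_ (sym (rank-from i)) (sym (rank-from j)) i<j)
    where
      rank-from : ∀ i → rank (Inverse.from π i) ≡ toℕ i
      rank-from i = cong toℕ (Inverse.strictlyInverseˡ π i)

  Endpoint : V → E → Set
  Endpoint x e = proj₁ (ends G e) ≡ x ⊎ proj₂ (ends G e) ≡ x

  other-just : ∀ {x e w} → other x e ≡ just w → ends G e ≡ (x , w) ⊎ ends G e ≡ (w , x)
  other-just {x} {e} eq with ends G e
  ... | (a , b) with a ≟ x | b ≟ x | eq
  ...   | yes refl | _        | refl = inj₁ refl
  ...   | no _     | yes refl | refl = inj₂ refl
  ...   | no _     | no _     | ()

  endpoint⇒other : ∀ {x e} → Endpoint x e → ∃[ w ] other x e ≡ just w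
  endpoint⇒other {x} {e} x∈e with ends G e
  ... | (a , b) with a ≟ x | b ≟ x | x∈e
  ...   | yes _   | _       | _        = b , refl
  ...   | no _    | yes _   | _        = a , refl
  ...   | no a≢x  | no _    | inj₁ a≡x = contradiction a≡x a≢x
  ...   | no _    | no b≢x  | inj₂ b≡x = contradiction b≡x b≢x

  other-source : ∀ {x e w} → other x e ≡ just w → Endpoint x e
  other-source eq with other-just eq
  ... | inj₁ ends≡ = inj₁ (cong proj₁ ends≡)
  ... | inj₂ ends≡ = inj₂ (cong proj₂ ends≡)

  other-target : ∀ {x e w} → other x e ≡ just w → Endpoint w e
  other-target eq with other-just eq
  ... | inj₁ ends≡ = inj₂ (cong proj₂ ends≡)
  ... | inj₂ ends≡ = inj₁ (cong proj₁ ends≡)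

  ==⇒≡ : ∀ {k} {x y : Fin k} → T (x == y) → x ≡ y
  ==⇒≡ {x = x} {y} _ with x ≟ y
  ... | yes x≡y = x≡y

  ==-refl : ∀ {k} (x : Fin k) → T (x == x)
  ==-refl x with x ≟ x
  ... | yes _   = _
  ... | no x≢x = x≢x refl

  adjacent-shared : ∀ {e f x} → e ≢ f → Endpoint x e → Endpoint x f → T (adjacent e f)
  adjacent-shared {e} {f} {x} e≢f x∈e x∈f with ends G e | ends G f | e ≟ f
  ... | _ | _ | yes e≡f = e≢f e≡f
  ... | (a , b) | (c , d) | no _ = shared x∈e x∈f
    where
      shared : a ≡ x ⊎ b ≡ x → c ≡ x ⊎ d ≡ x → T ((a == c) ∨ (a == d) ∨ (b == c) ∨ (b == d))
      shared (inj₁ refl) (inj₁ refl) = T-∨⁺ˡ (==-refl a)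
      shared (inj₁ refl) (inj₂ refl) = T-∨⁺ʳ (a == c) (T-∨⁺ˡ (==-refl a))
      shared (inj₂ refl) (inj₁ refl) = T-∨⁺ʳ (a == c) (T-∨⁺ʳ (a == d) (T-∨⁺ˡ (==-refl b)))
      shared (inj₂ refl) (inj₂ refl) = T-∨⁺ʳ (a == c) (T-∨⁺ʳ (a == d) (T-∨⁺ʳ (b == c) (==-refl b)))

  adjacent-irrefl : ∀ f → ¬ T (adjacent f f)
  adjacent-irrefl f with ends G f | f ≟ f
  ... | _ | yes _  = λ ()
  ... | _ | no f≢f = contradiction refl f≢f

  -- Rounds of the parallel algorithm

  allAlive : Alive
  allAlive _ = true

  aliveAfter : ℕ → Alive
  aliveAfter = fold allAlive step

  step-⊆ : ∀ {a x} → T (step a x) → T (a x)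
  step-⊆ = proj₁ ∘ to T-∧

  edgeAlive-mono : ∀ {a b : Alive} → (∀ {x} → T (a x) → T (b x)) →
                   ∀ {e} → T (edgeAlive a e) → T (edgeAlive b e)
  edgeAlive-mono a⊆b = from T-∧ ∘ Product.map a⊆b a⊆b ∘ to T-∧

  edgeAlive⁺ : ∀ {a : Alive} {x e w} → other x e ≡ just w → T (a x) → T (a w) → T (edgeAlive a e)
  edgeAlive⁺ eq ax aw with other-just eq
  ... | inj₁ ends≡ rewrite ends≡ = from T-∧ (ax , aw)
  ... | inj₂ ends≡ rewrite ends≡ = from T-∧ (aw , ax)

  edgeAlive⁻ : ∀ {a : Alive} {x e} → Endpoint x e → T (edgeAlive a e) → T (a x)
  edgeAlive⁻ (inj₁ refl) = proj₁ ∘ to T-∧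
  edgeAlive⁻ (inj₂ refl) = proj₂ ∘ to T-∧

  minimalAgainst : Alive → E → E → Bool
  minimalAgainst a e f = not (edgeAlive a f ∧ adjacent e f) ∨ (rank e <ᵇ rank f)

  localMin⁻ : ∀ {a e} → T (localMin a e) →
              T (edgeAlive a e) × (∀ {f} → T (edgeAlive a f) → T (adjacent e f) → rank e < rank f)
  localMin⁻ {a} {e} lm = proj₁ parts , λ {f} af adj →
    <ᵇ⇒< _ _ (T-not-∨⁻ (All.lookup (All.all⁺ (minimalAgainst a e) _ (proj₂ parts)) (∈-allFin f))
                       (from T-∧ (af , adj)))
    where
      parts : T (edgeAlive a e) × T (all (minimalAgainst a e) (allFin (m G)))
      parts = to T-∧ lm

  localMin⁺ : ∀ {a e} → T (edgeAlive a e) →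
              (∀ {f} → T (edgeAlive a f) → T (adjacent e f) → rank e < rank f) → T (localMin a e)
  localMin⁺ {a} {e} ae minimal = from T-∧ (ae , All.all⁻ (minimalAgainst a e) {allFin (m G)}
    (All.tabulate λ {f} _ → T-not-∨⁺ {edgeAlive a f ∧ adjacent e f} λ af∧adj →
      <⇒<ᵇ (uncurry minimal (to T-∧ af∧adj))))

  -- Records rather than T-predicates, so that rounds, vertices and edges are inferred
  -- by unification.
  record AliveAt (t : ℕ) (x : V) : Set where
    constructor alive
    field holds : T (aliveAfter t x)

  record EdgeAliveAt (t : ℕ) (e : E) : Set where
    constructor edge-alive
    field holds : T (edgeAlive (aliveAfter t) e)

  record MatchedAt (t : ℕ) (g : E) : Set where
    constructor matched
    field holds : T (localMin (aliveAfter t) g)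

  alive? : ∀ t x → Dec (AliveAt t x)
  alive? t x = map′ alive AliveAt.holds (T? (aliveAfter t x))

  edgeAlive? : ∀ t e → Dec (EdgeAliveAt t e)
  edgeAlive? t e = map′ edge-alive EdgeAliveAt.holds (T? (edgeAlive (aliveAfter t) e))

  endpoint-alive : ∀ {t x e} → Endpoint x e → EdgeAliveAt t e → AliveAt t x
  endpoint-alive {t} x∈e (edge-alive h) = alive (edgeAlive⁻ {aliveAfter t} x∈e h)

  edgeAliveAt⁺ : ∀ {t x e w} → other x e ≡ just w → AliveAt t x → AliveAt t w → EdgeAliveAt t e
  edgeAliveAt⁺ {t} o (alive hx) (alive hw) = edge-alive (edgeAlive⁺ {aliveAfter t} o hx hw)

  alive-antitone : ∀ {t t′ x} → t ≤ t′ → AliveAt t′ x → AliveAt t x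
  alive-antitone t≤t′ (alive h) = alive (antitone (≤⇒≤′ t≤t′) h)
    where
      antitone : ∀ {t t′ x} → t ≤′ t′ → T (aliveAfter t′ x) → T (aliveAfter t x)
      antitone (≤′-reflexive refl) = id
      antitone (≤′-step {n} t≤′n) = antitone t≤′n ∘ step-⊆ {aliveAfter n}

  edgeAlive-antitone : ∀ {t t′ e} → t ≤ t′ → EdgeAliveAt t′ e → EdgeAliveAt t e
  edgeAlive-antitone {t} {t′} t≤t′ (edge-alive h) =
    edge-alive (edgeAlive-mono {aliveAfter t′} {aliveAfter t} (AliveAt.holds ∘ alive-antitone t≤t′ ∘ alive) h)

  matched⇒alive : ∀ {t g} → MatchedAt t g → EdgeAliveAt t g
  matched⇒alive {t} (matched h) = edge-alive (proj₁ (localMin⁻ {aliveAfter t} h))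

  matched-minimal : ∀ {t g f} → MatchedAt t g → EdgeAliveAt t f → T (adjacent g f) → rank g < rank f
  matched-minimal {t} (matched h) (edge-alive hf) = proj₂ (localMin⁻ {aliveAfter t} h) hf

  removes : Alive → V → E → Bool
  removes a x e = localMin a e ∧ ((proj₁ (ends G e) == x) ∨ (proj₂ (ends G e) == x))

  matched⇒removed : ∀ {t g x} → MatchedAt t g → Endpoint x g → ¬ AliveAt (suc t) x
  matched⇒removed {t} {g} {x} (matched lm) x∈g (alive h) =
    T-not⇒¬T (proj₂ (to T-∧ h))
      (Any.any⁺ (removes (aliveAfter t) x) (lose (∈-allFin g) (g-removes x∈g)))
    where
      g-removes : Endpoint x g → T (removes (aliveAfter t) x g)
      g-removes (inj₁ refl) = from T-∧ (lm , T-∨⁺ˡ (==-refl x))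
      g-removes (inj₂ refl) = from T-∧ (lm , T-∨⁺ʳ _ (==-refl x))

  removed⇒matched : ∀ {t x} → AliveAt t x → ¬ AliveAt (suc t) x → ∃[ g ] MatchedAt t g × Endpoint x g
  removed⇒matched {t} {x} (alive h) dead
    with Any.satisfied (Any.any⁻ (removes (aliveAfter t) x) (allFin (m G))
           (T-∧-not⁻ {c = any (removes (aliveAfter t) x) (allFin (m G))} h (dead ∘ alive)))
  ... | g , g-removes with to T-∧ g-removes
  ...   | lm , hit with to T-∨ hit
  ...     | inj₁ hit₁ = g , matched lm , inj₁ (==⇒≡ hit₁)
  ...     | inj₂ hit₂ = g , matched lm , inj₂ (==⇒≡ hit₂)

  unmatched-survives : ∀ {t x} → AliveAt t x → (∀ {g} → MatchedAt t g → ¬ Endpoint x g) → AliveAt (suc t) x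
  unmatched-survives {t} {x} x-alive unmatched with alive? (suc t) x
  ... | yes survives = survives
  ... | no dead with removed⇒matched x-alive dead
  ...   | g , lm , x∈g = contradiction x∈g (unmatched lm)

  dead-after-rank : ∀ f → ¬ EdgeAliveAt (suc (rank f)) f
  dead-after-rank f = dead f (<-wellFounded (rank f))
    where
      dead : ∀ f → Acc _<_ (rank f) → ¬ EdgeAliveAt (suc (rank f)) f
      dead f (acc smaller) f-alive =
        matched⇒removed f-matched (inj₁ refl) (endpoint-alive (inj₁ refl) f-alive)
        where
          f-minimal : ∀ {h} → T (edgeAlive (aliveAfter (rank f)) h) → T (adjacent f h) → rank f < rank h
          f-minimal {h} h-alive adj with <-cmp (rank f) (rank h)
          ... | tri< f<h _ _ = f<h
          ... | tri≈ _ f≡h _ =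
            ⊥-elim (adjacent-irrefl f (subst (T ∘ adjacent f) (sym (rank-injective f≡h)) adj))
          ... | tri> _ _ h<f =
            contradiction (edgeAlive-antitone h<f (edge-alive h-alive)) (dead h (smaller h<f))

          f-matched : MatchedAt (rank f) f
          f-matched = matched (localMin⁺ {aliveAfter (rank f)}
                        (EdgeAliveAt.holds (edgeAlive-antitone (n≤1+n (rank f)) f-alive)) f-minimal)

  alive⇒round≤rank : ∀ {j e} → EdgeAliveAt j e → j ≤ rank e
  alive⇒round≤rank e-alive = ≮⇒≥ λ rank<j → dead-after-rank _ (edgeAlive-antitone rank<j e-alive)

  iterate-step-⊆ : ∀ a j {x} → T (iterate step a j x) → T (a x)
  iterate-step-⊆ a zero    = id
  iterate-step-⊆ a (suc j) = step-⊆ {a} ∘ iterate-step-⊆ (step a) j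

  some-edge-alive : ∀ a j {e} → T (edgeAlive (iterate step a j) e) → T (any (edgeAlive a) (allFin (m G)))
  some-edge-alive a j {e} e-alive =
    Any.any⁺ (edgeAlive a)
      (lose (∈-allFin e) (edgeAlive-mono {iterate step a j} {a} (iterate-step-⊆ a j) e-alive))

  rounds-suc : ∀ K a → T (any (edgeAlive a) (allFin (m G))) → rounds (suc K) a ≡ suc (rounds K (step a))
  rounds-suc K a some-alive with any (edgeAlive a) (allFin (m G))
  ... | true  = refl
  ... | false = ⊥-elim some-alive

  -- rounds recurses on the later state step a, which matches iterate rather than fold.
  rounds-lowerBound : ∀ K a j {e} → T (edgeAlive (iterate step a j) e) → j < K → j < rounds K a
  rounds-lowerBound (suc K) a zero e-alive _
    rewrite rounds-suc K a (some-edge-alive a zero e-alive) = s≤s z≤n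
  rounds-lowerBound (suc K) a (suc j) e-alive (s≤s j<K)
    rewrite rounds-suc K a (some-edge-alive a (suc j) e-alive) =
      s≤s (rounds-lowerBound K (step a) j e-alive j<K)

  alive⇒round<ρ : ∀ {j e} → EdgeAliveAt j e → j < ρ G π
  alive⇒round<ρ {j} {e} e-alive@(edge-alive h) =
    rounds-lowerBound (m G) allAlive j (subst (λ a → T (edgeAlive a e)) (iterate-is-fold allAlive step j) h)
                      (≤-<-trans (alive⇒round≤rank e-alive) (rank<m e))

  -- The greedy matching

  FreeBelow : V → ℕ → Set
  FreeBelow x r = ∀ {t g} → MatchedAt t g → Endpoint x g → r ≤ rank g

  matched-touching⇒≤ : ∀ {t g f y} → MatchedAt t g → EdgeAliveAt t f → Endpoint y g → Endpoint y f →
                       rank g ≤ rank f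
  matched-touching⇒≤ {g = g} {f} lm f-alive y∈g y∈f with g ≟ f
  ... | yes refl = ≤-refl
  ... | no g≢f   = <⇒≤ (matched-minimal lm f-alive (adjacent-shared g≢f y∈g y∈f))

  matched⇒freeBelow : ∀ {t g y} → MatchedAt t g → Endpoint y g → FreeBelow y (rank g)
  matched⇒freeBelow {t} lm y∈g {t′} lm′ y∈g′ with <-cmp t t′
  ... | tri< t<t′ _ _ = contradiction (endpoint-alive y∈g′ (edgeAlive-antitone t<t′ (matched⇒alive lm′)))
                                      (matched⇒removed lm y∈g)
  ... | tri> _ _ t′<t = contradiction (endpoint-alive y∈g (edgeAlive-antitone t′<t (matched⇒alive lm)))
                                      (matched⇒removed lm′ y∈g′)
  ... | tri≈ _ refl _ = matched-touching⇒≤ lm (matched⇒alive lm′) y∈g y∈g′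

  freeBelow-matched⇒≡ : ∀ {t g x e} → FreeBelow x (rank e) → MatchedAt t g → Endpoint x g → Endpoint x e →
                        EdgeAliveAt t e → g ≡ e
  freeBelow-matched⇒≡ free lm x∈g x∈e e-alive =
    rank-injective (≤-antisym (matched-touching⇒≤ lm e-alive x∈g x∈e) (free lm x∈g))

  dying-edge : ∀ {t u f w} → other u f ≡ just w → EdgeAliveAt t f → ¬ EdgeAliveAt (suc t) f →
               ∃[ g ] MatchedAt t g × (Endpoint u g ⊎ Endpoint w g)
  dying-edge {t} {u} o f-alive f-dies with alive? (suc t) u
  ... | no u-dies =
    Product.map₂ (Product.map₂ inj₁) (removed⇒matched (endpoint-alive (other-source o) f-alive) u-dies)
  ... | yes u-survives =
    Product.map₂ (Product.map₂ inj₂) (removed⇒matched (endpoint-alive (other-target o) f-alive)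
                                                      (f-dies ∘ edgeAliveAt⁺ o u-survives))

  greedy-maximal : ∀ {u f w} → other u f ≡ just w → FreeBelow w (rank f) →
                   ∃[ t ] ∃[ g ] MatchedAt t g × Endpoint u g × rank g ≤ rank f
  greedy-maximal {f = f} o w-free
    with crossing (λ t → edgeAlive? t f) (edge-alive _) (suc (rank f)) (dead-after-rank f)
  ... | t , f-alive , f-dies with dying-edge o f-alive f-dies
  ...   | g , lm , inj₁ u∈g = t , g , lm , u∈g , matched-touching⇒≤ lm f-alive u∈g (other-source o)
  ...   | g , lm , inj₂ w∈g with freeBelow-matched⇒≡ w-free lm w∈g (other-target o) f-alive
  ...     | refl = t , g , lm , other-source o , ≤-refl

  near-endpoint-survives : ∀ {s x e y e′ z} → FreeBelow x (rank e) →
                           other x e ≡ just y → other y e′ ≡ just z → rank e′ < rank e →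
                           EdgeAliveAt s e → EdgeAliveAt s e′ → AliveAt (suc s) x
  near-endpoint-survives {s} {x} {e} {e′ = e′} x-free o o′ e′<e e-alive e′-alive =
    unmatched-survives (endpoint-alive (other-source o) e-alive) unmatched
    where
      unmatched : ∀ {g} → MatchedAt s g → ¬ Endpoint x g
      unmatched lm x∈g with freeBelow-matched⇒≡ x-free lm x∈g (other-source o) e-alive
      ... | refl =
        <-asym e′<e (matched-minimal lm e′-alive (adjacent-shared e≢e′ (other-target o) (other-source o′)))
        where
          e≢e′ : e ≢ e′
          e≢e′ e≡e′ = <⇒≢ e′<e (cong rank (sym e≡e′))

  outlives : ∀ {x e y e′ z} → other x e ≡ just y → other y e′ ≡ just z → rank e′ < rank e →
             FreeBelow x (rank e) → ∀ s → EdgeAliveAt s e′ → EdgeAliveAt s e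
  outlives o o′ e′<e x-free zero    _        = edge-alive _
  outlives {e′ = e′} o o′ e′<e x-free (suc s) e′-alive =
    edgeAliveAt⁺ o
      (near-endpoint-survives x-free o o′ e′<e (outlives o o′ e′<e x-free s e′-alive-s) e′-alive-s)
      (endpoint-alive (other-source o′) e′-alive)
    where
      e′-alive-s : EdgeAliveAt s e′
      e′-alive-s = edgeAlive-antitone (n≤1+n s) e′-alive

  outlives-by-a-round : ∀ {x e y e′ z e″ w} → other x e ≡ just y → other y e′ ≡ just z → other z e″ ≡ just w →
                        rank e′ < rank e → rank e″ < rank e′ → FreeBelow x (rank e) → FreeBelow y (rank e′) →
                        ∀ s → EdgeAliveAt s e″ → EdgeAliveAt (suc s) e
  outlives-by-a-round {e = e} {e′ = e′} o o′ o″ e′<e e″<e′ x-free y-free s e″-alive =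
    edgeAliveAt⁺ o (near-endpoint-survives x-free o o′ e′<e e-alive e′-alive)
                   (near-endpoint-survives y-free o′ o″ e″<e′ e′-alive e″-alive)
    where
      e′-alive : EdgeAliveAt s e′
      e′-alive = outlives o′ o″ e″<e′ y-free s e″-alive

      e-alive : EdgeAliveAt s e
      e-alive = outlives o o′ e′<e x-free s e′-alive

  -- Query chains

  Below : Maybe E → E → Set
  Below nothing  f = ⊤
  Below (just e) f = rank f < rank e

  below-trans : ∀ l {f g} → rank g < rank f → Below l f → Below l g
  below-trans nothing  _   _   = _
  below-trans (just e) g<f f<e = <-trans g<f f<e

  data QueryChain (v : V) : ℕ → List E → V → Maybe E → Set where
    []     : QueryChain v 0 [] v nothing
    extend : ∀ {k p x l e w} → QueryChain v k p x l → other x e ≡ just w → FreeBelow x (rank e) → Below l e →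
             QueryChain v (suc k) (p ++ e ∷ []) w (just e)

  QueryChain-length : ∀ {v k p x l} → QueryChain v k p x l → length p ≡ k
  QueryChain-length []                                = refl
  QueryChain-length (extend {p = p} {e = e} c _ _ _) =
    trans (length-++-comm p (e ∷ [])) (cong suc (QueryChain-length c))

  chain-alive : ∀ {v k p x e} → QueryChain v (suc k) p x (just e) →
                ∀ s → EdgeAliveAt s e → ∃[ f ] EdgeAliveAt (⌊ k /2⌋ + s) f
  chain-alive (extend [] _ _ _)                s e-alive = _ , e-alive
  chain-alive (extend (extend [] _ _ _) _ _ _) s e-alive = _ , e-alive
  chain-alive {k = suc (suc k)}
              (extend (extend (extend c o₁ free₀ below₁) o₂ free₁ e₂<e₁) o₃ _ e₃<e₂) s e₃-alive
    with chain-alive (extend c o₁ free₀ below₁) (suc s)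
                     (outlives-by-a-round o₁ o₂ o₃ e₂<e₁ e₃<e₂ free₀ free₁ s e₃-alive)
  ... | f , f-alive = f , subst (λ r → EdgeAliveAt r f) (+-suc ⌊ k /2⌋ s) f-alive

  half-length≤ρ : ∀ {v k p x l} → QueryChain v k p x l → ⌊ k /2⌋ ≤ ρ G π
  half-length≤ρ []                                = z≤n
  half-length≤ρ {k = suc k} c@(extend _ _ _ _) with chain-alive c 0 (edge-alive _)
  ... | f , f-alive = ≤-trans (⌊n/2⌋-mono (n≤1+n (suc k)))
                              (alive⇒round<ρ (subst (λ r → EdgeAliveAt r f) (+-identityʳ ⌊ k /2⌋) f-alive))

  -- The oracles

  incidentStep : V → E → Maybe (E × V)
  incidentStep u f = Maybe.map (f ,_) (other u f)

  lowerStep : E → V → E → Maybe (E × V)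
  lowerStep e u f = if rank f <ᵇ rank e then incidentStep u f else nothing

  incidentStep-just : ∀ {u f y} → incidentStep u f ≡ just y → proj₁ y ≡ f × other u f ≡ just (proj₂ y)
  incidentStep-just {u} {f} eq with other u f
  incidentStep-just refl | just w = refl , refl

  lowerStep-just : ∀ {e u f y} → lowerStep e u f ≡ just y → rank f < rank e × incidentStep u f ≡ just y
  lowerStep-just {e} {u} {f} eq with rank f <ᵇ rank e | <ᵇ-reflects-< (rank f) (rank e)
  ... | true | ofʸ f<e = f<e , eq

  lowerStep-below : ∀ {e u f} → rank f < rank e → lowerStep e u f ≡ incidentStep u f
  lowerStep-below {e} {u} {f} f<e with rank f <ᵇ rank e | <ᵇ-reflects-< (rank f) (rank e)
  ... | true  | _       = refl
  ... | false | ofⁿ f≮e = contradiction f<e f≮e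

  lowerStep-key : ∀ {e u f y} → lowerStep e u f ≡ just y → proj₁ y ≡ f
  lowerStep-key = proj₁ ∘ incidentStep-just ∘ proj₂ ∘ lowerStep-just

  Increasing : List (E × V) → Set
  Increasing = AllPairs (_<_ on (rank ∘ proj₁))

  ∈-incident⁻ : ∀ {u f w} → (f , w) ∈ incident u → other u f ≡ just w
  ∈-incident⁻ {u} = proj₂ ∘ incidentStep-just ∘ ∈-mapMaybe-key⁻ (proj₁ ∘ incidentStep-just {u}) {edgesByRank}

  ∈-incident⁺ : ∀ {u f w} → other u f ≡ just w → (f , w) ∈ incident u
  ∈-incident⁺ {u} {f} o = ∈-mapMaybe⁺ (incidentStep u) (∈-edgesByRank f) (cong (Maybe.map (f ,_)) o)

  incident-increasing : ∀ u → Increasing (incident u)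
  incident-increasing u = AllPairs-mapMaybe-key (proj₁ ∘ incidentStep-just) edgesByRank-increasing

  ∈-lowerIncident⁻ : ∀ {e u f w} → (f , w) ∈ lowerIncident e u → rank f < rank e × other u f ≡ just w
  ∈-lowerIncident⁻ {e} {u} mem with lowerStep-just (∈-mapMaybe-key⁻ (lowerStep-key {e} {u}) {edgesByRank} mem)
  ... | f<e , eq = f<e , proj₂ (incidentStep-just eq)

  ∈-lowerIncident⁺ : ∀ {e u f w} → rank f < rank e → other u f ≡ just w → (f , w) ∈ lowerIncident e u
  ∈-lowerIncident⁺ {e} {u} {f} f<e o =
    ∈-mapMaybe⁺ (lowerStep e u) (∈-edgesByRank f) (trans (lowerStep-below f<e) (cong (Maybe.map (f ,_)) o))

  lowerIncident-increasing : ∀ e u → Increasing (lowerIncident e u)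
  lowerIncident-increasing e u = AllPairs-mapMaybe-key lowerStep-key edgesByRank-increasing

  FreeItem : E × V → Set
  FreeItem (f , w) = FreeBelow w (rank f)

  -- The recursion evaluated by EO(e,u).
  ¬freeLowerNeighbour⇔freeBelow : ∀ e u → (¬ Any FreeItem (lowerIncident e u)) ⇔ FreeBelow u (rank e)
  ¬freeLowerNeighbour⇔freeBelow e u = mk⇔ unblocked blocked
    where
      blocked : FreeBelow u (rank e) → ¬ Any FreeItem (lowerIncident e u)
      blocked u-free free-neighbour with find free-neighbour
      ... | (f , w) , mem , w-free with ∈-lowerIncident⁻ mem
      ...   | f<e , o with greedy-maximal o w-free
      ...     | t , g , lm , u∈g , g≤f = <⇒≱ (≤-<-trans g≤f f<e) (u-free lm u∈g)

      unblocked : ¬ Any FreeItem (lowerIncident e u) → FreeBelow u (rank e)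
      unblocked none lm u∈g = ≮⇒≥ λ g<e →
        let w , o = endpoint⇒other u∈g
        in none (lose (∈-lowerIncident⁺ g<e o) (matched⇒freeBelow lm (other-target o)))

  MemoSound : Memo → Set
  MemoSound = All λ entry → Reflects (FreeItem (proj₁ entry)) (proj₂ entry)

  lookupMemo-sound : ∀ {memo e u b} → MemoSound memo → lookupMemo memo e u ≡ just b →
                     Reflects (FreeBelow u (rank e)) b
  lookupMemo-sound {((f , w) , _) ∷ memo} {e} {u} (r ∷ rs) eq with f ≟ e | w ≟ u | eq
  ... | yes refl | yes refl | refl = r
  ... | yes _    | no _     | eq′  = lookupMemo-sound rs eq′
  ... | no _     | _        | eq′  = lookupMemo-sound rs eq′

  module OracleSoundness (v : V) where

    IsQueryChain : Stack → Set
    IsQueryChain p = ∃[ k ] ∃[ x ] ∃[ l ] QueryChain v k p x l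

    Sound : Set → Bool × Memo × Stacks → Set
    Sound P (b , memo , stacks) = Reflects P b × MemoSound memo × All IsQueryChain stacks

    Candidate : V → Maybe E → ℕ → E × V → Set
    Candidate x l fuel (f , w) = other x f ≡ just w × Below l f × rank f < fuel

    Covers : V → Maybe E → List (E × V) → Set
    Covers x l xs = ∀ {t g} → MatchedAt t g → Endpoint x g → Below l g → ∃[ w ] (g , w) ∈ xs

    head-free : ∀ {x l f w xs} → Covers x l ((f , w) ∷ xs) → All ((_<_ on (rank ∘ proj₁)) (f , w)) xs →
                Below l f → FreeBelow x (rank f)
    head-free {l = l} {f} covers f<xs f-below lm x∈g = ≮⇒≥ λ g<f →
      case covers lm x∈g (below-trans l g<f f-below) of λ where
        (_ , here refl)  → <-irrefl refl g<f
        (_ , there mem) → <-asym g<f (All.lookup f<xs mem)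

    covers-tail : ∀ {x l f w xs} → other x f ≡ just w → ¬ FreeItem (f , w) →
                  Covers x l ((f , w) ∷ xs) → Covers x l xs
    covers-tail o w-bound covers lm x∈g g-below with covers lm x∈g g-below
    ... | _ , here refl = ⊥-elim (w-bound (matched⇒freeBelow lm (other-target o)))
    ... | w′ , there mem = w′ , mem

    mutual
      EO-sound : ∀ fuel stk e u memo {k} → QueryChain v k (stk ++ e ∷ []) u (just e) → rank e < fuel →
                 MemoSound memo → Sound (FreeBelow u (rank e)) (EO fuel stk e u memo)
      EO-sound fuel stk e u memo chain e<fuel memo-sound with lookupMemo memo e u in eq
      ... | just b  = lookupMemo-sound memo-sound eq , memo-sound , (_ , _ , _ , chain) ∷ []
      ... | nothing = EO-compute-sound fuel (stk ++ e ∷ []) e u memo chain e<fuel memo-sound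

      EO-compute-sound : ∀ fuel stk e u memo {k} → QueryChain v k stk u (just e) → rank e < fuel →
                         MemoSound memo → Sound (FreeBelow u (rank e)) (EO-compute fuel stk e u memo)
      EO-compute-sound zero       _   _ _ _    _     ()          _
      EO-compute-sound (suc fuel) stk e u memo chain (s≤s e≤fuel) memo-sound
        with loop fuel stk (lowerIncident e u) memo
           | loop-sound fuel stk (lowerIncident e u) memo chain
               (All.tabulate λ mem → let f<e , o = ∈-lowerIncident⁻ mem in o , f<e , <-≤-trans f<e e≤fuel)
               (lowerIncident-increasing e u)
               (λ lm u∈g g<e → let w , o = endpoint⇒other u∈g in w , ∈-lowerIncident⁺ g<e o)
               memo-sound
      ... | r , memo′ , stacks | r-sound , memo′-sound , stacks-sound =
            answer , answer ∷ memo′-sound , (_ , _ , _ , chain) ∷ stacks-sound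
        where
          answer : Reflects (FreeBelow u (rank e)) (not r)
          answer = Reflects-⇔ (¬freeLowerNeighbour⇔freeBelow e u) (¬-reflects r-sound)

      loop-sound : ∀ fuel stk xs memo {k x l} → QueryChain v k stk x l → All (Candidate x l fuel) xs →
                   Increasing xs → Covers x l xs → MemoSound memo →
                   Sound (Any FreeItem xs) (loop fuel stk xs memo)
      loop-sound fuel stk [] memo _ _ _ _ memo-sound = ofⁿ (λ ()) , memo-sound , []
      loop-sound fuel stk ((f , w) ∷ xs) memo chain ((o , f-below , f<fuel) ∷ candidates) (f<xs ∷ increasing)
                 covers memo-sound
        with EO fuel stk f w memo
           | EO-sound fuel stk f w memo (extend chain o (head-free covers f<xs f-below) f-below)
                      f<fuel memo-sound
      ... | true  , memo′ , stacks | ofʸ w-free , memo′-sound , stacks-sound =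
            ofʸ (here w-free) , memo′-sound , stacks-sound
      ... | false , memo′ , stacks | ofⁿ w-bound , memo′-sound , stacks-sound
        with loop fuel stk xs memo′
           | loop-sound fuel stk xs memo′ chain candidates increasing
                        (covers-tail o w-bound covers) memo′-sound
      ... | r , memo″ , stacks′ | r-sound , memo″-sound , stacks′-sound =
            there-reflects w-bound r-sound , memo″-sound , All.++⁺ stacks-sound stacks′-sound

    queryPaths-chains : All IsQueryChain (queryPaths v)
    queryPaths-chains =
      proj₂ (proj₂ (loop-sound (m G) [] (incident v) [] [] candidates (incident-increasing v) covers []))
      where
        candidates : All (Candidate v nothing (m G)) (incident v)
        candidates = All.tabulate λ mem → ∈-incident⁻ mem , _ , rank<m _

        covers : Covers v nothing (incident v)
        covers _ v∈g _ = let w , o = endpoint⇒other v∈g in w , ∈-incident⁺ o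

claim3p22 : (G : SimpleGraph) (π : Ranking G) (v : Vertex G) (P : List (Edge G)) →
    IsQueryPath G π v P → ⌊ length P /2⌋ ≤ ρ G π
claim3p22 G π v P P∈queryPaths = bound (All.lookup queryPaths-chains P∈queryPaths)
  where
    open Greedy G π
    open OracleSoundness v

    bound : IsQueryChain P → ⌊ length P /2⌋ ≤ ρ G π
    bound (_ , _ , _ , chain) =
      subst (λ n → ⌊ n /2⌋ ≤ ρ G π) (sym (QueryChain-length chain)) (half-length≤ρ chain)
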